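{- Let $u$ and $v$ be positive integers with $v$ squarefree, and let $Q=\operatorname{lcm}(8,u,v)$. Then there exists a residue class $q$ modulo $Q$ with $\gcd(q,Q)=1$ such that every prime $p\equiv q\pmod Q$ satisfies $$p^2-1\equiv 0\pmod u\quad\text{and}\quad \left(\frac{ -v}{p}\right)=-1.$$ Furthermore, if $v$ has a prime divisor congruent to $3$ modulo $4$ and $8\mid u$, then $q$ can additionally be chosen so that every such prime $p$ also satisfies $v_2(p^2-1)=v_2(Q)$.
   Context: $\left(\frac{\cdot}{p}\right)$ denotes the Legendre symbol. For a prime $\ell$ and a nonzero integer $n$, $v_\ell(n)=\max\{e\ge 0: \ell^e\mid n\}$. -}

module Defs where

open import Data.Nat using (ℕ; suc; _*_; _^_; _∸_; _<_; _%_)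
open import Data.Nat.Divisibility using (_∣_)
open import Data.Nat.Primality using (Prime)
open import Data.Nat.LCM using (lcm)
open import Data.Nat.Coprimality using (Coprime)
open import Data.Integer as ℤ using (ℤ; +_)
import Data.Integer.Divisibility as ℤD
open import Data.Product using (_×_; ∃)
open import Relation.Nullary using (¬_)
open import Relation.Binary.PropositionalEquality using (_≡_)

SquareFree : ℕ → Set
SquareFree v = ∀ d → d * d ∣ v → d ≡ 1

_≡_[mod_] : ℕ → ℕ → ℕ → Set
a ≡ b [mod m ] = (+ m) ℤD.∣ ((+ a) ℤ.- (+ b))

IsSquareMod : ℤ → ℕ → Set
IsSquareMod a p = ∃ λ (x : ℤ) → (+ p) ℤD.∣ (x ℤ.* x ℤ.- a)

LegendreMinusOne : ℤ → ℕ → Set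
LegendreMinusOne a p = ¬ ((+ p) ℤD.∣ a) × ¬ IsSquareMod a p

HasValuation : ℕ → ℕ → ℕ → Set
HasValuation ℓ n e = ℓ ^ e ∣ n × ¬ (ℓ ^ suc e ∣ n)

SameValuation : ℕ → ℕ → ℕ → Set
SameValuation ℓ a b = ∃ λ e → HasValuation ℓ a e × HasValuation ℓ b e

GoodClass : ℕ → ℕ → ℕ → ℕ → Set
GoodClass u v Q q =
  q < Q × Coprime q Q ×
  (∀ p → Prime p → p ≡ q [mod Q ] →
     (u ∣ p * p ∸ 1) × LegendreMinusOne (ℤ.- (+ v)) p)

{-# OPTIONS --safe #-}

-- Write Q = 8c. If v ∣ c we take q = Q/2 - 1; otherwise squarefreeness forces v = 2w with w odd and
-- c odd, and we take q = Q/2 + 1. A prime p = 2h + 1 ≡ q (mod Q) then has h odd and v ∣ (h+1)/2 in the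
-- first case, and h ≡ 2 (mod 4) and w ∣ h/2 in the second. By Euler's criterion it suffices to show
-- (-v)^h ≡ -1 (mod p), and the powers a^h involved are computed with Gauss's lemma: when a L is h + 1
-- or h, the Gauss signs of a, a·2, ..., a·h are constant on consecutive blocks of length L and alternate
-- from block to block, so a^h ≡ 1 for L even and 2^h ≡ -1 when h/2 is odd. Fermat's little theorem,
-- needed for Euler's criterion, also comes out of Gauss's lemma because the signs square to 1.
-- In both cases p² - 1 is Q times an odd number, which gives u ∣ p² - 1 and v₂(p² - 1) = v₂(Q) at
-- once.

module Submission where

open import Defs
open import Data.Nat
open import Data.Nat.Properties
open import Data.Nat.Divisibility
open import Data.Nat.DivMod using (_/_; m≡m%n+[m/n]*n; m%n<n; [m+kn]%n≡m%n; m<n⇒m%n≡m)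
open import Data.Nat.Coprimality using (Coprime; coprime-divisor)
open import Data.Nat.Primality using (Prime; euclidsLemma; prime⇒nonTrivial)
open import Data.Nat.LCM using (lcm; m∣lcm[m,n]; n∣lcm[m,n]; lcm-least)
open import Data.Nat.Induction using (<-rec)
open import Data.Nat.ListAction using (product)
open import Data.Nat.ListAction.Properties using (product-↭)
import Data.Nat.Tactic.RingSolver as ℕ-Solver
open import Data.Integer as ℤ using (ℤ; +_; 0ℤ; 1ℤ; -1ℤ)
import Data.Integer.Properties as ℤ
open import Data.Integer.Divisibility.Signed as ℤ∣ using () renaming (_∣_ to _∣ℤ_)
import Data.Integer.Tactic.RingSolver as ℤ-Solver
open import Data.List using (List; []; _∷_; _++_; length; applyDownFrom)
open import Data.List.Properties using (length-applyDownFrom)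
open import Data.List.Relation.Unary.All as All using (All; []; _∷_)
open import Data.List.Relation.Unary.All.Properties using (¬Any⇒All¬; applyDownFrom⁺₁)
open import Data.List.Relation.Unary.AllPairs using (_∷_)
open import Data.List.Relation.Unary.Unique.Propositional using (Unique)
import Data.List.Relation.Unary.Unique.Propositional.Properties as Unique
open import Data.List.Membership.Propositional using (_∈_; _∉_)
open import Data.List.Membership.Propositional.Properties using (∈-∃++)
open import Data.List.Membership.DecPropositional _≟_ using (_∈?_)
open import Data.List.Relation.Binary.Permutation.Propositional using (_↭_; ↭⇒↭ₛ)
open import Data.List.Relation.Binary.Permutation.Propositional.Properties using (shift; ↭-length; All-resp-↭)
open import Data.List.Relation.Binary.Permutation.Setoid.Properties using (Unique-resp-↭)
open import Data.Product using (_×_; _,_; proj₁; proj₂; ∃; ∃₂)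
open import Data.Sum using (_⊎_; inj₁; inj₂; [_,_]′)
open import Data.Empty using (⊥; ⊥-elim)
open import Function using (_∘_)
open import Relation.Nullary using (¬_; yes; no)
open import Relation.Binary.Bundles using (Setoid)
open import Relation.Binary.Structures using (IsEquivalence)
open import Relation.Binary.PropositionalEquality
import Relation.Binary.Reasoning.Setoid as SetoidReasoning

∣∧<⇒≡0 : ∀ {m n} → m ∣ n → n < m → n ≡ 0
∣∧<⇒≡0 {n = zero} _ _ = refl
∣∧<⇒≡0 {n = suc n} m∣n n<m = ⊥-elim (>⇒∤ n<m m∣n)

k+a*s≤a*L : ∀ {k a s L} → k ≤ a → s < L → k + a * s ≤ a * L
k+a*s≤a*L {k} {a} {s} {L} k≤a s<L = begin
  k + a * s      ≤⟨ +-monoˡ-≤ (a * s) k≤a ⟩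
  a + a * s      ≡⟨ *-suc a s ⟨
  a * suc s      ≤⟨ *-monoʳ-≤ a s<L ⟩
  a * L          ∎
  where open ≤-Reasoning

lcm-nonZero : ∀ m n → .{{NonZero m}} → .{{NonZero n}} → NonZero (lcm m n)
lcm-nonZero m n = ≢-nonZero λ lcm≡0 →
  ≢-nonZero⁻¹ (m * n) {{m*n≢0 m n}} (0∣⇒≡0 (subst (_∣ m * n) lcm≡0 (lcm-least {m} {n} (m∣m*n n) (n∣m*n m))))

even⊎odd : ∀ n → ∃ λ m → n ≡ 2 * m ⊎ n ≡ 1 + 2 * m
even⊎odd zero = 0 , inj₁ refl
even⊎odd (suc zero) = 0 , inj₂ refl
even⊎odd (suc (suc n)) with even⊎odd n
... | m , inj₁ refl = suc m , inj₁ (sym (*-suc 2 m))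
... | m , inj₂ refl = suc m , inj₂ (cong suc (sym (*-suc 2 m)))

odd-coprime-2 : ∀ o → Coprime (1 + 2 * o) 2
odd-coprime-2 o {d} (d∣odd , d∣2) =
  ∣1⇒≡1 (∣m+n∣m⇒∣n (subst (d ∣_) (+-comm 1 (2 * o)) d∣odd) (∣-trans d∣2 (m∣m*n o)))

2∤odd : ∀ o → ¬ 2 ∣ 1 + 2 * o
2∤odd o 2∣odd with odd-coprime-2 o (2∣odd , ∣-refl)
... | ()

odd∣2*⇒∣ : ∀ o {n} → 1 + 2 * o ∣ 2 * n → 1 + 2 * o ∣ n
odd∣2*⇒∣ o = coprime-divisor (odd-coprime-2 o)

odd∣8*⇒∣ : ∀ o {n} → 1 + 2 * o ∣ 8 * n → 1 + 2 * o ∣ n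
odd∣8*⇒∣ o {n} d = odd∣2*⇒∣ o (odd∣2*⇒∣ o (odd∣2*⇒∣ o (subst (1 + 2 * o ∣_) (8*≡2*2*2* n) d)))
  where
  8*≡2*2*2* : ∀ n → 8 * n ≡ 2 * (2 * (2 * n))
  8*≡2*2*2* = ℕ-Solver.solve-∀

odd²∸1 : ∀ h → (1 + 2 * h) * (1 + 2 * h) ∸ 1 ≡ 4 * h * suc h
odd²∸1 h = expand h
  where
  expand : ∀ h → 2 * h + 2 * h * (1 + 2 * h) ≡ 4 * h * suc h
  expand = ℕ-Solver.solve-∀

odd*odd : ∀ a b → (1 + 2 * a) * (1 + 2 * b) ≡ 1 + 2 * (a + b + 2 * a * b)
odd*odd = ℕ-Solver.solve-∀

2^k*odd-decomposition : ∀ n → .{{NonZero n}} → ∃₂ λ k o → n ≡ 2 ^ k * (1 + 2 * o)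
2^k*odd-decomposition = <-rec _ step
  where
  step : ∀ n → (∀ {m} → m < n → .{{NonZero m}} → ∃₂ λ k o → m ≡ 2 ^ k * (1 + 2 * o)) →
         .{{NonZero n}} → ∃₂ λ k o → n ≡ 2 ^ k * (1 + 2 * o)
  step n rec with even⊎odd n
  ... | o , inj₂ n≡odd = 0 , o , trans n≡odd (sym (+-identityʳ _))
  ... | suc m , inj₁ refl with rec (m<m+n (suc m) z<s)
  ...   | k , o , m≡ = suc k , o , trans (cong (2 *_) m≡) (sym (*-assoc 2 (2 ^ k) _))

hasValuation-2^k*odd : ∀ k o → HasValuation 2 (2 ^ k * (1 + 2 * o)) k
hasValuation-2^k*odd k o = m∣m*n (1 + 2 * o) , λ 2^[1+k]∣ →
  2∤odd o (*-cancelˡ-∣ (2 ^ k) {{m^n≢0 2 k}} (subst (_∣ 2 ^ k * (1 + 2 * o)) (*-comm 2 (2 ^ k)) 2^[1+k]∣))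

sameValuation-*odd : ∀ n o → .{{NonZero n}} → SameValuation 2 (n * (1 + 2 * o)) n
sameValuation-*odd n o with 2^k*odd-decomposition n
... | k , o′ , refl = k , subst (λ m → HasValuation 2 m k) (sym n*odd≡) (hasValuation-2^k*odd k (o′ + o + 2 * o′ * o)) ,
                          hasValuation-2^k*odd k o′
  where
  n*odd≡ : 2 ^ k * (1 + 2 * o′) * (1 + 2 * o) ≡ 2 ^ k * (1 + 2 * (o′ + o + 2 * o′ * o))
  n*odd≡ = trans (*-assoc (2 ^ k) _ _) (cong (2 ^ k *_) (odd*odd o′ o))

∏ : ℕ → (ℕ → ℤ) → ℤ
∏ zero f = 1ℤ
∏ (suc n) f = ∏ n f ℤ.* f n

infix 5 ∏
syntax ∏ n (λ i → e) = ∏[ i < n ] e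

∏-const : ∀ n {f : ℕ → ℤ} {c} → (∀ {i} → i < n → f i ≡ c) → ∏ n f ≡ c ℤ.^ n
∏-const zero f≡c = refl
∏-const (suc n) {c = c} f≡c =
  trans (cong₂ ℤ._*_ (∏-const n (λ i<n → f≡c (m<n⇒m<1+n i<n))) (f≡c ≤-refl)) (ℤ.*-comm (c ℤ.^ n) c)

∏-distrib-* : ∀ n (f g : ℕ → ℤ) → ∏[ i < n ] (f i ℤ.* g i) ≡ ∏ n f ℤ.* ∏ n g
∏-distrib-* zero f g = refl
∏-distrib-* (suc n) f g =
  trans (cong (ℤ._* (f n ℤ.* g n)) (∏-distrib-* n f g)) (interchange (∏ n f) (∏ n g) (f n) (g n))
  where
  interchange : ∀ x y z w → (x ℤ.* y) ℤ.* (z ℤ.* w) ≡ (x ℤ.* z) ℤ.* (y ℤ.* w)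
  interchange = ℤ-Solver.solve-∀

∏-+ : ∀ m n (f : ℕ → ℤ) → ∏ (m + n) f ≡ ∏ m f ℤ.* (∏[ i < n ] f (m + i))
∏-+ m zero f = trans (cong (λ k → ∏ k f) (+-identityʳ m)) (sym (ℤ.*-identityʳ (∏ m f)))
∏-+ m (suc n) f = begin
  ∏ (m + suc n) f                                   ≡⟨ cong (λ k → ∏ k f) (+-suc m n) ⟩
  ∏ (m + n) f ℤ.* f (m + n)                         ≡⟨ cong (ℤ._* f (m + n)) (∏-+ m n f) ⟩
  ∏ m f ℤ.* (∏[ i < n ] f (m + i)) ℤ.* f (m + n)    ≡⟨ ℤ.*-assoc (∏ m f) _ _ ⟩
  ∏ m f ℤ.* ((∏[ i < n ] f (m + i)) ℤ.* f (m + n))  ∎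
  where open ≡-Reasoning

∏-blocks : ∀ a L (f B : ℕ → ℤ) → (∀ {t s} → t < a → s < L → f (t * L + s) ≡ B t) →
           ∏ (a * L) f ≡ ∏[ t < a ] B t ℤ.^ L
∏-blocks zero L f B f≡B = refl
∏-blocks (suc a) L f B f≡B = begin
  ∏ (suc a * L) f                                   ≡⟨ cong (λ k → ∏ k f) (+-comm L (a * L)) ⟩
  ∏ (a * L + L) f                                   ≡⟨ ∏-+ (a * L) L f ⟩
  ∏ (a * L) f ℤ.* (∏[ s < L ] f (a * L + s))       ≡⟨ cong₂ ℤ._*_ (∏-blocks a L f B (λ t<a → f≡B (m<n⇒m<1+n t<a)))
                                                                   (∏-const L (f≡B ≤-refl)) ⟩
  (∏[ t < a ] B t ℤ.^ L) ℤ.* B a ℤ.^ L              ∎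
  where open ≡-Reasoning

∏-a*[1+i] : ∀ a n → ∏[ i < n ] + (a * suc i) ≡ (+ a) ℤ.^ n ℤ.* + (n !)
∏-a*[1+i] a zero = refl
∏-a*[1+i] a (suc n) = begin
  (∏[ i < n ] + (a * suc i)) ℤ.* + (a * suc n)      ≡⟨ cong₂ ℤ._*_ (∏-a*[1+i] a n) (ℤ.pos-* a (suc n)) ⟩
  (+ a) ℤ.^ n ℤ.* + (n !) ℤ.* (+ a ℤ.* + suc n)         ≡⟨ regroup (+ a) ((+ a) ℤ.^ n) (+ (n !)) (+ suc n) ⟩
  + a ℤ.* (+ a) ℤ.^ n ℤ.* (+ suc n ℤ.* + (n !))         ≡⟨ cong ((+ a) ℤ.^ suc n ℤ.*_) (sym (ℤ.pos-* (suc n) (n !))) ⟩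
  (+ a) ℤ.^ suc n ℤ.* + (suc n !)                       ∎
  where
  open ≡-Reasoning
  regroup : ∀ x y z w → y ℤ.* z ℤ.* (x ℤ.* w) ≡ x ℤ.* y ℤ.* (w ℤ.* z)
  regroup = ℤ-Solver.solve-∀

∏-+-product : ∀ n (f : ℕ → ℕ) → ∏[ i < n ] + f i ≡ + product (applyDownFrom f n)
∏-+-product zero f = refl
∏-+-product (suc n) f = begin
  (∏[ i < n ] + f i) ℤ.* + f n                      ≡⟨ cong (ℤ._* + f n) (∏-+-product n f) ⟩
  + product (applyDownFrom f n) ℤ.* + f n           ≡⟨ ℤ.*-comm _ (+ f n) ⟩
  + f n ℤ.* + product (applyDownFrom f n)           ≡⟨ sym (ℤ.pos-* (f n) _) ⟩
  + product (applyDownFrom f (suc n))               ∎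
  where open ≡-Reasoning

^-distrib-* : ∀ x y n → (x ℤ.* y) ℤ.^ n ≡ x ℤ.^ n ℤ.* y ℤ.^ n
^-distrib-* x y zero = refl
^-distrib-* x y (suc n) = trans (cong ((x ℤ.* y) ℤ.*_) (^-distrib-* x y n)) (interchange x y (x ℤ.^ n) (y ℤ.^ n))
  where
  interchange : ∀ x y z w → (x ℤ.* y) ℤ.* (z ℤ.* w) ≡ (x ℤ.* z) ℤ.* (y ℤ.* w)
  interchange = ℤ-Solver.solve-∀

-1^[2*k]≡1 : ∀ k → -1ℤ ℤ.^ (2 * k) ≡ 1ℤ
-1^[2*k]≡1 k = trans (sym (ℤ.^-*-assoc -1ℤ 2 k)) (ℤ.^-zeroˡ k)

-1^[1+2*k]≡-1 : ∀ k → -1ℤ ℤ.^ (1 + 2 * k) ≡ -1ℤ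
-1^[1+2*k]≡-1 k = cong (-1ℤ ℤ.*_) (-1^[2*k]≡1 k)

∏[-1^t]^[2*X]≡1 : ∀ a X → ∏[ t < a ] (-1ℤ ℤ.^ t) ℤ.^ (2 * X) ≡ 1ℤ
∏[-1^t]^[2*X]≡1 a X = trans (∏-const a (λ {t} _ → even-power t)) (ℤ.^-zeroˡ a)
  where
  even-power : ∀ t → (-1ℤ ℤ.^ t) ℤ.^ (2 * X) ≡ 1ℤ
  even-power t = begin
    (-1ℤ ℤ.^ t) ℤ.^ (2 * X)    ≡⟨ ℤ.^-*-assoc -1ℤ t (2 * X) ⟩
    -1ℤ ℤ.^ (t * (2 * X))      ≡⟨ cong (-1ℤ ℤ.^_) (*-comm-2 t X) ⟩
    -1ℤ ℤ.^ (2 * (t * X))      ≡⟨ -1^[2*k]≡1 (t * X) ⟩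
    1ℤ                         ∎
    where
    open ≡-Reasoning
    *-comm-2 : ∀ t X → t * (2 * X) ≡ 2 * (t * X)
    *-comm-2 = ℕ-Solver.solve-∀

0^n≡0 : ∀ {n} → 0 < n → 0ℤ ℤ.^ n ≡ 0ℤ
0^n≡0 {suc n} _ = refl

module Modℤ (m : ℕ) where

  -- A record rather than a bare divisibility statement, so that x and y can be inferred.
  infix 4 _≈_
  record _≈_ (x y : ℤ) : Set where
    constructor ∣-diff
    field divides-diff : + m ∣ℤ x ℤ.- y
  open _≈_ public

  ≡⇒≈ : ∀ {x y} → x ≡ y → x ≈ y
  ≡⇒≈ {x} refl = ∣-diff (subst (+ m ∣ℤ_) (sym (ℤ.+-inverseʳ x)) (ℤ∣.divides 0ℤ refl))

  ≈-sym : ∀ {x y} → x ≈ y → y ≈ x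
  ≈-sym {x} {y} (∣-diff m∣x-y) = ∣-diff (subst (+ m ∣ℤ_) (diff-swap x y) (ℤ∣.∣m⇒∣-m m∣x-y))
    where
    diff-swap : ∀ x y → ℤ.- (x ℤ.- y) ≡ y ℤ.- x
    diff-swap = ℤ-Solver.solve-∀

  ≈-trans : ∀ {x y z} → x ≈ y → y ≈ z → x ≈ z
  ≈-trans {x} {y} {z} (∣-diff m∣x-y) (∣-diff m∣y-z) =
    ∣-diff (subst (+ m ∣ℤ_) (diff-telescope x y z) (ℤ∣.∣m∣n⇒∣m+n m∣x-y m∣y-z))
    where
    diff-telescope : ∀ x y z → (x ℤ.- y) ℤ.+ (y ℤ.- z) ≡ x ℤ.- z
    diff-telescope = ℤ-Solver.solve-∀

  ≈-isEquivalence : IsEquivalence _≈_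
  ≈-isEquivalence = record { refl = ≡⇒≈ refl ; sym = ≈-sym ; trans = ≈-trans }

  ≈-setoid : Setoid _ _
  ≈-setoid = record { isEquivalence = ≈-isEquivalence }

  module ≈-Reasoning = SetoidReasoning ≈-setoid

  +-cong : ∀ {x y u v} → x ≈ y → u ≈ v → x ℤ.+ u ≈ y ℤ.+ v
  +-cong {x} {y} {u} {v} (∣-diff m∣x-y) (∣-diff m∣u-v) =
    ∣-diff (subst (+ m ∣ℤ_) (diff-+ x y u v) (ℤ∣.∣m∣n⇒∣m+n m∣x-y m∣u-v))
    where
    diff-+ : ∀ x y u v → (x ℤ.- y) ℤ.+ (u ℤ.- v) ≡ (x ℤ.+ u) ℤ.- (y ℤ.+ v)
    diff-+ = ℤ-Solver.solve-∀

  *-cong : ∀ {x y u v} → x ≈ y → u ≈ v → x ℤ.* u ≈ y ℤ.* v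
  *-cong {x} {y} {u} {v} (∣-diff m∣x-y) (∣-diff m∣u-v) =
    ∣-diff (subst (+ m ∣ℤ_) (diff-* x y u v) (ℤ∣.∣m∣n⇒∣m+n (ℤ∣.∣m⇒∣m*n u m∣x-y) (ℤ∣.∣n⇒∣m*n y m∣u-v)))
    where
    diff-* : ∀ x y u v → (x ℤ.- y) ℤ.* u ℤ.+ y ℤ.* (u ℤ.- v) ≡ x ℤ.* u ℤ.- y ℤ.* v
    diff-* = ℤ-Solver.solve-∀

  ^-cong : ∀ {x y} n → x ≈ y → x ℤ.^ n ≈ y ℤ.^ n
  ^-cong zero x≈y = ≡⇒≈ refl
  ^-cong (suc n) x≈y = *-cong x≈y (^-cong n x≈y)

  ∏-cong-≈ : ∀ n {f g : ℕ → ℤ} → (∀ {i} → i < n → f i ≈ g i) → ∏ n f ≈ ∏ n g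
  ∏-cong-≈ zero f≈g = ≡⇒≈ refl
  ∏-cong-≈ (suc n) f≈g = *-cong (∏-cong-≈ n (λ i<n → f≈g (m<n⇒m<1+n i<n))) (f≈g ≤-refl)

  ≈0⇒∣ : ∀ {x} → x ≈ 0ℤ → + m ∣ℤ x
  ≈0⇒∣ {x} (∣-diff m∣x-0) = subst (+ m ∣ℤ_) (ℤ.+-identityʳ x) m∣x-0

  ∣⇒≈0 : ∀ {x} → + m ∣ℤ x → x ≈ 0ℤ
  ∣⇒≈0 {x} m∣x = ∣-diff (subst (+ m ∣ℤ_) (sym (ℤ.+-identityʳ x)) m∣x)

  x+k*m≈x : ∀ x k → x ℤ.+ k ℤ.* + m ≈ x
  x+k*m≈x x k = ∣-diff (subst (+ m ∣ℤ_) (sym (cancel x k (+ m))) (ℤ∣.∣n⇒∣m*n k ℤ∣.∣-refl))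
    where
    cancel : ∀ x k m → x ℤ.+ k ℤ.* m ℤ.- x ≡ k ℤ.* m
    cancel = ℤ-Solver.solve-∀

InRange : ℕ → ℕ → Set
InRange n x = 0 < x × x ≤ n

inRange-pred : ∀ {m xs} → All (InRange (suc m)) xs → suc m ∉ xs → All (InRange m) xs
inRange-pred {m} {xs} in-range m+1∉xs = All.zipWith lower (in-range , ¬Any⇒All¬ xs m+1∉xs)
  where
  lower : ∀ {x} → InRange (suc m) x × suc m ≢ x → InRange m x
  lower ((0<x , x≤m+1) , x≢m+1) = 0<x , m<1+n⇒m≤n (≤∧≢⇒< x≤m+1 (x≢m+1 ∘ sym))

remove-top : ∀ {m xs} → Unique xs → All (InRange (suc m)) xs → suc m ∈ xs →
             ∃ λ ys → xs ↭ suc m ∷ ys × Unique ys × All (InRange m) ys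
remove-top {m} unique in-range m+1∈xs with ys , zs , refl ← ∈-∃++ m+1∈xs
  with m+1∉ ∷ unique-rest ← Unique-resp-↭ (setoid ℕ) (↭⇒↭ₛ (shift (suc m) ys zs)) unique
  = ys ++ zs , xs↭ , unique-rest ,
    inRange-pred (All.tail (All-resp-↭ xs↭ in-range)) (λ m+1∈ → All.lookup m+1∉ m+1∈ refl)
  where
  xs↭ : ys ++ suc m ∷ zs ↭ suc m ∷ ys ++ zs
  xs↭ = shift (suc m) ys zs

unique∧inRange⇒length≤ : ∀ n {xs} → Unique xs → All (InRange n) xs → length xs ≤ n
unique∧inRange⇒length≤ zero _ [] = z≤n
unique∧inRange⇒length≤ zero _ ((0<x , x≤0) ∷ _) = ⊥-elim (<⇒≱ 0<x x≤0)
unique∧inRange⇒length≤ (suc m) {xs} unique in-range with suc m ∈? xs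
... | yes m+1∈xs with ys , xs↭ , unique-ys , in-range-ys ← remove-top unique in-range m+1∈xs =
  ≤-trans (≤-reflexive (↭-length xs↭)) (s≤s (unique∧inRange⇒length≤ m unique-ys in-range-ys))
... | no m+1∉xs = m≤n⇒m≤1+n (unique∧inRange⇒length≤ m unique (inRange-pred in-range m+1∉xs))

unique∧inRange⇒product≡! : ∀ n {xs} → Unique xs → All (InRange n) xs → length xs ≡ n → product xs ≡ n !
unique∧inRange⇒product≡! zero {[]} _ _ _ = refl
unique∧inRange⇒product≡! (suc m) {xs} unique in-range length≡ with suc m ∈? xs
... | yes m+1∈xs with ys , xs↭ , unique-ys , in-range-ys ← remove-top unique in-range m+1∈xs =
  trans (product-↭ xs↭)
    (cong (suc m *_) (unique∧inRange⇒product≡! m unique-ys in-range-ys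
      (suc-injective (trans (sym (↭-length xs↭)) length≡))))
... | no m+1∉xs = ⊥-elim (<⇒≱ (≤-reflexive (sym length≡))
                    (unique∧inRange⇒length≤ m unique (inRange-pred in-range m+1∉xs)))

-- Gauss's lemma and Euler's criterion modulo an odd prime

module OddPrime (h : ℕ) (p-prime : Prime (1 + 2 * h)) where

  p : ℕ
  p = 1 + 2 * h

  open Modℤ p

  1<p : 1 < p
  1<p = nonTrivial⇒n>1 p {{prime⇒nonTrivial p-prime}}

  0<h : 0 < h
  0<h = n≢0⇒n>0 λ { refl → <-irrefl refl 1<p }

  h<p : h < p
  h<p = s≤s (m≤m+n h (h + 0))

  1+h<p : suc h < p
  1+h<p = s≤s (m<m+n h (≤-trans 0<h (m≤m+n h 0)))

  3≤p : 3 ≤ p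
  3≤p = s≤s (+-mono-≤ 0<h (≤-trans 0<h (m≤m+n h 0)))

  ¬p∣-below : ∀ {n} → 0 < n → n < p → ¬ p ∣ n
  ¬p∣-below 0<n n<p = >⇒∤ {{>-nonZero 0<n}} n<p

  p∤! : ∀ {n} → n < p → ¬ p ∣ n !
  p∤! {zero} _ = ¬p∣-below z<s 1<p
  p∤! {suc n} n<p p∣n! with euclidsLemma (suc n) (n !) p-prime p∣n!
  ... | inj₁ p∣n = ¬p∣-below z<s n<p p∣n
  ... | inj₂ p∣n! = p∤! (<⇒≤ n<p) p∣n!

  euclidsLemmaℤ : ∀ x y → + p ∣ℤ x ℤ.* y → + p ∣ℤ x ⊎ + p ∣ℤ y
  euclidsLemmaℤ x y p∣xy with euclidsLemma ℤ.∣ x ∣ ℤ.∣ y ∣ p-prime (subst (p ∣_) (ℤ.abs-* x y) (ℤ∣.∣⇒∣ᵤ p∣xy))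
  ... | inj₁ p∣x = inj₁ (ℤ∣.∣ᵤ⇒∣ p∣x)
  ... | inj₂ p∣y = inj₂ (ℤ∣.∣ᵤ⇒∣ p∣y)

  *-cancelʳ-≈ : ∀ {n x y} → ¬ p ∣ n → x ℤ.* + n ≈ y ℤ.* + n → x ≈ y
  *-cancelʳ-≈ {n} {x} {y} p∤n (∣-diff p∣xn-yn) =
    [ ∣-diff , ⊥-elim ∘ p∤n ∘ ℤ∣.∣⇒∣ᵤ ]′ (euclidsLemmaℤ (x ℤ.- y) (+ n) (subst (+ p ∣ℤ_) (factor x y (+ n)) p∣xn-yn))
    where
    factor : ∀ x y n → x ℤ.* n ℤ.- y ℤ.* n ≡ (x ℤ.- y) ℤ.* n
    factor = ℤ-Solver.solve-∀

  ≤∧≈⇒≡ : ∀ {i j} → i ≤ j → j < p → + i ≈ + j → i ≡ j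
  ≤∧≈⇒≡ {i} {j} i≤j j<p (∣-diff p∣i-j) = ≤-antisym i≤j (m∸n≡0⇒m≤n (∣∧<⇒≡0 p∣j∸i (≤-<-trans (m∸n≤m j i) j<p)))
    where
    p∣j∸i : p ∣ j ∸ i
    p∣j∸i = subst (p ∣_) (trans (cong ℤ.∣_∣ (ℤ.m-n≡m⊖n i j)) (ℤ.∣⊖∣-≤ i≤j)) (ℤ∣.∣⇒∣ᵤ p∣i-j)

  +≈+⇒≡ : ∀ {i j} → i < p → j < p → + i ≈ + j → i ≡ j
  +≈+⇒≡ {i} {j} i<p j<p i≈j with ≤-total i j
  ... | inj₁ i≤j = ≤∧≈⇒≡ i≤j j<p i≈j
  ... | inj₂ j≤i = sym (≤∧≈⇒≡ j≤i i<p (≈-sym i≈j))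

  -1≉0 : ¬ -1ℤ ≈ 0ℤ
  -1≉0 (∣-diff p∣1) = ¬p∣-below z<s 1<p (ℤ∣.∣⇒∣ᵤ p∣1)

  -1≉1 : ¬ -1ℤ ≈ 1ℤ
  -1≉1 (∣-diff p∣2) = ¬p∣-below z<s 3≤p (ℤ∣.∣⇒∣ᵤ p∣2)

  -1*[p∸r]≈r : ∀ {r} → r ≤ p → -1ℤ ℤ.* + (p ∸ r) ≈ + r
  -1*[p∸r]≈r {r} r≤p = begin
    -1ℤ ℤ.* + (p ∸ r)                          ≡⟨ cong (-1ℤ ℤ.*_) (sym (trans (ℤ.m-n≡m⊖n p r) (ℤ.⊖-≥ r≤p))) ⟩
    -1ℤ ℤ.* (+ p ℤ.- + r)                      ≡⟨ rearrange (+ p) (+ r) ⟩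
    + r ℤ.+ -1ℤ ℤ.* + p                        ≈⟨ x+k*m≈x (+ r) -1ℤ ⟩
    + r                                        ∎
    where
    open ≈-Reasoning
    rearrange : ∀ p r → -1ℤ ℤ.* (p ℤ.- r) ≡ r ℤ.+ -1ℤ ℤ.* p
    rearrange = ℤ-Solver.solve-∀

  module Gauss (a : ℕ) where

    open ≈-Reasoning

    residue : ℕ → ℕ
    residue j = a * j % p

    gaussSign : ℕ → ℤ
    gaussSign j with residue j ≤? h
    ... | yes _ = 1ℤ
    ... | no _ = -1ℤ

    absLeastResidue : ℕ → ℕ
    absLeastResidue j with residue j ≤? h
    ... | yes _ = residue j
    ... | no _ = p ∸ residue j

    gaussSign≡±1 : ∀ j → gaussSign j ≡ 1ℤ ⊎ gaussSign j ≡ -1ℤ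
    gaussSign≡±1 j with residue j ≤? h
    ... | yes _ = inj₁ refl
    ... | no _ = inj₂ refl

    gaussSign² : ∀ j → gaussSign j ℤ.* gaussSign j ≡ 1ℤ
    gaussSign² j with residue j ≤? h
    ... | yes _ = refl
    ... | no _ = refl

    residue≡ : ∀ {j R} k → a * j ≡ R + k * p → R < p → residue j ≡ R
    residue≡ {j} {R} k a*j≡ R<p = trans (cong (_% p) a*j≡) (trans ([m+kn]%n≡m%n R k p) (m<n⇒m%n≡m R<p))

    gaussSign-low : ∀ {j R} k → a * j ≡ R + k * p → R ≤ h → gaussSign j ≡ 1ℤ
    gaussSign-low {j} {R} k a*j≡ R≤h with residue j ≤? h
    ... | yes _ = refl
    ... | no r≰h = ⊥-elim (r≰h (subst (_≤ h) (sym (residue≡ k a*j≡ (≤-<-trans R≤h h<p))) R≤h))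

    gaussSign-high : ∀ {j R} k → a * j ≡ R + k * p → h < R → R < p → gaussSign j ≡ -1ℤ
    gaussSign-high {j} {R} k a*j≡ h<R R<p with residue j ≤? h
    ... | yes r≤h = ⊥-elim (<⇒≱ h<R (subst (_≤ h) (residue≡ k a*j≡ R<p) r≤h))
    ... | no _ = refl

    a*j≈residue : ∀ j → + (a * j) ≈ + residue j
    a*j≈residue j = begin
      + (a * j)                                  ≡⟨ cong +_ (m≡m%n+[m/n]*n (a * j) p) ⟩
      + (residue j + a * j / p * p)              ≡⟨ trans (ℤ.pos-+ (residue j) _) (cong (ℤ._+_ (+ residue j)) (ℤ.pos-* (a * j / p) p)) ⟩
      + residue j ℤ.+ + (a * j / p) ℤ.* + p      ≈⟨ x+k*m≈x (+ residue j) (+ (a * j / p)) ⟩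
      + residue j                                ∎

    a*j≈±absLeastResidue : ∀ j → + (a * j) ≈ gaussSign j ℤ.* + absLeastResidue j
    a*j≈±absLeastResidue j with residue j ≤? h
    ... | yes _ = ≈-trans (a*j≈residue j) (≡⇒≈ (sym (ℤ.*-identityˡ _)))
    ... | no _ = ≈-trans (a*j≈residue j) (≈-sym (-1*[p∸r]≈r (<⇒≤ (m%n<n (a * j) p))))

    module _ (p∤a : ¬ p ∣ a) where

      residue≢0 : ∀ {j} → 0 < j → j < p → residue j ≢ 0
      residue≢0 {j} 0<j j<p r≡0 with euclidsLemma a j p-prime (m%n≡0⇒n∣m (a * j) p r≡0)
      ... | inj₁ p∣a = p∤a p∣a
      ... | inj₂ p∣j = ¬p∣-below 0<j j<p p∣j

      absLeastResidue-inRange : ∀ {j} → 0 < j → j < p → InRange h (absLeastResidue j)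
      absLeastResidue-inRange {j} 0<j j<p with residue j ≤? h
      ... | yes r≤h = n≢0⇒n>0 (residue≢0 0<j j<p) , r≤h
      ... | no r≰h = m<n⇒0<n∸m (m%n<n (a * j) p) , m≤n+o⇒m∸n≤o p (residue j) p≤r+h
        where
        p≤r+h : p ≤ residue j + h
        p≤r+h = subst (_≤ residue j + h) (cong (λ n → suc (h + n)) (sym (+-identityʳ h))) (+-monoˡ-≤ h (≰⇒> r≰h))

      same-residue⇒≡ : ∀ {i j} → i < p → j < p → + (a * i) ≈ + (a * j) → i ≡ j
      same-residue⇒≡ {i} {j} i<p j<p ai≈aj = +≈+⇒≡ i<p j<p (*-cancelʳ-≈ p∤a (begin
        + i ℤ.* + a   ≡⟨ sym (trans (ℤ.pos-* a i) (ℤ.*-comm (+ a) (+ i))) ⟩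
        + (a * i)     ≈⟨ ai≈aj ⟩
        + (a * j)     ≡⟨ trans (ℤ.pos-* a j) (ℤ.*-comm (+ a) (+ j)) ⟩
        + j ℤ.* + a   ∎))

      opposite-residues⇒⊥ : ∀ {i j} → 0 < i → i ≤ h → j ≤ h → + (a * i) ℤ.+ + (a * j) ≈ 0ℤ → ⊥
      opposite-residues⇒⊥ {i} {j} 0<i i≤h j≤h ai+aj≈0 =
        ¬p∣-below (≤-trans 0<i (m≤m+n i j)) i+j<p (ℤ∣.∣⇒∣ᵤ (≈0⇒∣ (*-cancelʳ-≈ {x = + (i + j)} p∤a (begin
          + (i + j) ℤ.* + a           ≡⟨ regroup ⟩
          + (a * i) ℤ.+ + (a * j)     ≈⟨ ai+aj≈0 ⟩
          0ℤ                          ≡⟨⟩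
          0ℤ ℤ.* + a                  ∎))))
        where
        i+j<p : i + j < p
        i+j<p = s≤s (+-mono-≤ i≤h (subst (j ≤_) (sym (+-identityʳ h)) j≤h))
        distrib : ∀ i j a → (i ℤ.+ j) ℤ.* a ≡ a ℤ.* i ℤ.+ a ℤ.* j
        distrib = ℤ-Solver.solve-∀
        regroup : + (i + j) ℤ.* + a ≡ + (a * i) ℤ.+ + (a * j)
        regroup = trans (cong (ℤ._* + a) (ℤ.pos-+ i j))
          (trans (distrib (+ i) (+ j) (+ a)) (sym (cong₂ ℤ._+_ (ℤ.pos-* a i) (ℤ.pos-* a j))))

      same-sign⇒≡ : ∀ {i j} → i ≤ h → j ≤ h → gaussSign i ≡ gaussSign j →
                    absLeastResidue i ≡ absLeastResidue j → i ≡ j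
      same-sign⇒≡ {i} {j} i≤h j≤h sᵢ≡sⱼ tᵢ≡tⱼ = same-residue⇒≡ (≤-<-trans i≤h h<p) (≤-<-trans j≤h h<p) (begin
        + (a * i)                             ≈⟨ a*j≈±absLeastResidue i ⟩
        gaussSign i ℤ.* + absLeastResidue i   ≡⟨ cong₂ (λ s t → s ℤ.* + t) sᵢ≡sⱼ tᵢ≡tⱼ ⟩
        gaussSign j ℤ.* + absLeastResidue j   ≈⟨ a*j≈±absLeastResidue j ⟨
        + (a * j)                             ∎)

      opposite-signs⇒⊥ : ∀ {i j} → 0 < i → i ≤ h → j ≤ h → gaussSign i ≡ 1ℤ → gaussSign j ≡ -1ℤ →
                         absLeastResidue i ≢ absLeastResidue j
      opposite-signs⇒⊥ {i} {j} 0<i i≤h j≤h sᵢ sⱼ tᵢ≡tⱼ = opposite-residues⇒⊥ 0<i i≤h j≤h (begin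
        + (a * i) ℤ.+ + (a * j)                                                ≈⟨ +-cong (a*j≈±absLeastResidue i) (a*j≈±absLeastResidue j) ⟩
        gaussSign i ℤ.* + absLeastResidue i ℤ.+ gaussSign j ℤ.* + absLeastResidue j
          ≡⟨ cong₂ (λ s t → s ℤ.* + t ℤ.+ gaussSign j ℤ.* + absLeastResidue j) sᵢ tᵢ≡tⱼ ⟩
        1ℤ ℤ.* + absLeastResidue j ℤ.+ gaussSign j ℤ.* + absLeastResidue j   ≡⟨ cong (λ s → 1ℤ ℤ.* + absLeastResidue j ℤ.+ s ℤ.* + absLeastResidue j) sⱼ ⟩
        1ℤ ℤ.* + absLeastResidue j ℤ.+ -1ℤ ℤ.* + absLeastResidue j           ≡⟨ cancel (+ absLeastResidue j) ⟩
        0ℤ                                                                     ∎)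
        where
        cancel : ∀ t → 1ℤ ℤ.* t ℤ.+ -1ℤ ℤ.* t ≡ 0ℤ
        cancel = ℤ-Solver.solve-∀

      absLeastResidue-injective : ∀ {i j} → 0 < i → i ≤ h → 0 < j → j ≤ h →
                                  absLeastResidue i ≡ absLeastResidue j → i ≡ j
      absLeastResidue-injective {i} {j} 0<i i≤h 0<j j≤h tᵢ≡tⱼ with gaussSign≡±1 i | gaussSign≡±1 j
      ... | inj₁ sᵢ | inj₁ sⱼ = same-sign⇒≡ i≤h j≤h (trans sᵢ (sym sⱼ)) tᵢ≡tⱼ
      ... | inj₂ sᵢ | inj₂ sⱼ = same-sign⇒≡ i≤h j≤h (trans sᵢ (sym sⱼ)) tᵢ≡tⱼ
      ... | inj₁ sᵢ | inj₂ sⱼ = ⊥-elim (opposite-signs⇒⊥ 0<i i≤h j≤h sᵢ sⱼ tᵢ≡tⱼ)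
      ... | inj₂ sᵢ | inj₁ sⱼ = ⊥-elim (opposite-signs⇒⊥ 0<j j≤h i≤h sⱼ sᵢ (sym tᵢ≡tⱼ))

      absLeastResidues : List ℕ
      absLeastResidues = applyDownFrom (absLeastResidue ∘ suc) h

      product-absLeastResidues : product absLeastResidues ≡ h !
      product-absLeastResidues = unique∧inRange⇒product≡! h
        (Unique.applyDownFrom⁺₁ (absLeastResidue ∘ suc) h λ j<i i<h tᵢ≡tⱼ →
          <⇒≢ j<i (sym (suc-injective (absLeastResidue-injective z<s i<h z<s (≤-trans j<i (<⇒≤ i<h)) tᵢ≡tⱼ))))
        (applyDownFrom⁺₁ (absLeastResidue ∘ suc) h λ i<h → absLeastResidue-inRange z<s (≤-<-trans i<h h<p))
        (length-applyDownFrom (absLeastResidue ∘ suc) h)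

      gauss-lemma : (+ a) ℤ.^ h ≈ ∏[ i < h ] gaussSign (suc i)
      gauss-lemma = *-cancelʳ-≈ (p∤! h<p) (begin
        (+ a) ℤ.^ h ℤ.* + (h !)                                     ≡⟨ ∏-a*[1+i] a h ⟨
        ∏[ i < h ] + (a * suc i)                                    ≈⟨ ∏-cong-≈ h (λ {i} _ → a*j≈±absLeastResidue (suc i)) ⟩
        ∏[ i < h ] gaussSign (suc i) ℤ.* + absLeastResidue (suc i)  ≡⟨ ∏-distrib-* h _ _ ⟩
        (∏[ i < h ] gaussSign (suc i)) ℤ.* (∏[ i < h ] + absLeastResidue (suc i))
          ≡⟨ cong (ℤ._*_ (∏[ i < h ] gaussSign (suc i))) (trans (∏-+-product h (absLeastResidue ∘ suc)) (cong +_ product-absLeastResidues)) ⟩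
        (∏[ i < h ] gaussSign (suc i)) ℤ.* + (h !)                  ∎)

  open Gauss using (gaussSign; gaussSign²; gaussSign-low; gaussSign-high; gauss-lemma)

  fermat-square : ∀ x → ¬ + p ∣ℤ x → (x ℤ.* x) ℤ.^ h ≈ 1ℤ
  fermat-square x p∤x = begin
    (x ℤ.* x) ℤ.^ h                               ≡⟨ cong (ℤ._^ h) (square-abs x) ⟩
    (+ n ℤ.* + n) ℤ.^ h                           ≡⟨ ^-distrib-* (+ n) (+ n) h ⟩
    (+ n) ℤ.^ h ℤ.* (+ n) ℤ.^ h                   ≈⟨ *-cong (gauss-lemma n p∤n) (gauss-lemma n p∤n) ⟩
    (∏[ i < h ] ε (suc i)) ℤ.* (∏[ i < h ] ε (suc i)) ≡⟨ ∏-distrib-* h (ε ∘ suc) (ε ∘ suc) ⟨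
    ∏[ i < h ] ε (suc i) ℤ.* ε (suc i)            ≡⟨ ∏-const h (λ {i} _ → gaussSign² n (suc i)) ⟩
    1ℤ ℤ.^ h                                      ≡⟨ ℤ.^-zeroˡ h ⟩
    1ℤ                                            ∎
    where
    n : ℕ
    n = ℤ.∣ x ∣
    ε : ℕ → ℤ
    ε = gaussSign n
    p∤n : ¬ p ∣ n
    p∤n = p∤x ∘ ℤ∣.∣ᵤ⇒∣
    square-abs : ∀ x → x ℤ.* x ≡ + ℤ.∣ x ∣ ℤ.* + ℤ.∣ x ∣
    square-abs (+ _) = refl
    square-abs ℤ.-[1+ _ ] = refl
    open ≈-Reasoning

  euler⇒nonResidue : ∀ a → a ℤ.^ h ≈ -1ℤ → LegendreMinusOne a p
  euler⇒nonResidue a a^h≈-1 = p∤a ∘ ℤ∣.∣ᵤ⇒∣ , not-square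
    where
    open ≈-Reasoning
    p∤a : ¬ + p ∣ℤ a
    p∤a p∣a = -1≉0 (begin
      -1ℤ           ≈⟨ a^h≈-1 ⟨
      a ℤ.^ h       ≈⟨ ^-cong h (∣⇒≈0 p∣a) ⟩
      0ℤ ℤ.^ h      ≡⟨ 0^n≡0 0<h ⟩
      0ℤ            ∎)
    not-square : ¬ IsSquareMod a p
    not-square (x , p∣x²-a) = -1≉1 (begin
      -1ℤ                ≈⟨ a^h≈-1 ⟨
      a ℤ.^ h            ≈⟨ ^-cong h x²≈a ⟨
      (x ℤ.* x) ℤ.^ h    ≈⟨ fermat-square x p∤x ⟩
      1ℤ                 ∎)
      where
      x²≈a : x ℤ.* x ≈ a
      x²≈a = ∣-diff (ℤ∣.∣ᵤ⇒∣ p∣x²-a)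
      p∤x : ¬ + p ∣ℤ x
      p∤x p∣x = p∤a (≈0⇒∣ (begin
        a          ≈⟨ x²≈a ⟨
        x ℤ.* x    ≈⟨ *-cong (∣⇒≈0 p∣x) (∣⇒≈0 p∣x) ⟩
        0ℤ         ∎))

  -- For j = t L + s with s < L, a j equals t (h + 1) + a s when a L = h + 1 (and a (j + 1) equals
  -- t h + a (s + 1) when a L = h), so the residue of a j lies in [0, h] exactly when t is even.
  module _ {a L : ℕ} where

    private
      ε : ℕ → ℤ
      ε = gaussSign a

    ∏gaussSign-blocks-of-1+h : a * L ≡ suc h → ∏[ i < h ] ε (suc i) ≡ ∏[ t < a ] (-1ℤ ℤ.^ t) ℤ.^ L
    ∏gaussSign-blocks-of-1+h aL≡1+h = begin
      ∏[ i < h ] ε (suc i)                    ≡⟨ ℤ.*-identityˡ _ ⟨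
      1ℤ ℤ.* (∏[ i < h ] ε (suc i))           ≡⟨ cong (λ x → 1ℤ ℤ.* x ℤ.* (∏[ i < h ] ε (suc i))) ε0≡1 ⟨
      ∏ 1 ε ℤ.* (∏[ i < h ] ε (1 + i))        ≡⟨ ∏-+ 1 h ε ⟨
      ∏ (suc h) ε                             ≡⟨ cong (λ n → ∏ n ε) aL≡1+h ⟨
      ∏ (a * L) ε                             ≡⟨ ∏-blocks a L ε (-1ℤ ℤ.^_) block-sign ⟩
      ∏[ t < a ] (-1ℤ ℤ.^ t) ℤ.^ L            ∎
      where
      open ≡-Reasoning
      ε0≡1 : ε 0 ≡ 1ℤ
      ε0≡1 = gaussSign-low a 0 (*-zeroʳ a) z≤n
      block-sign : ∀ {t s} → t < a → s < L → ε (t * L + s) ≡ -1ℤ ℤ.^ t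
      block-sign {t} {s} t<a s<L with even⊎odd t
      ... | m , inj₁ refl = trans (gaussSign-low a m eq R≤h) (sym (-1^[2*k]≡1 m))
        where
        eq : a * (2 * m * L + s) ≡ (m + a * s) + m * p
        eq = begin
          a * (2 * m * L + s)         ≡⟨ expand a m L s ⟩
          2 * m * (a * L) + a * s     ≡⟨ cong (λ n → 2 * m * n + a * s) aL≡1+h ⟩
          2 * m * suc h + a * s       ≡⟨ regroup m h a s ⟩
          (m + a * s) + m * p         ∎
          where
          expand : ∀ a m L s → a * (2 * m * L + s) ≡ 2 * m * (a * L) + a * s
          expand = ℕ-Solver.solve-∀
          regroup : ∀ m h a s → 2 * m * suc h + a * s ≡ (m + a * s) + m * (1 + 2 * h)
          regroup = ℕ-Solver.solve-∀
        R≤h : m + a * s ≤ h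
        R≤h = ≤-pred (subst (suc m + a * s ≤_) aL≡1+h (k+a*s≤a*L (≤-<-trans (m≤m+n m (m + 0)) t<a) s<L))
      ... | m , inj₂ refl = trans (gaussSign-high a m eq (s≤s (m≤m+n h _)) R<p) (sym (-1^[1+2*k]≡-1 m))
        where
        eq : a * ((1 + 2 * m) * L + s) ≡ suc (h + (m + a * s)) + m * p
        eq = begin
          a * ((1 + 2 * m) * L + s)          ≡⟨ expand a m L s ⟩
          (1 + 2 * m) * (a * L) + a * s      ≡⟨ cong (λ n → (1 + 2 * m) * n + a * s) aL≡1+h ⟩
          (1 + 2 * m) * suc h + a * s        ≡⟨ regroup m h a s ⟩
          suc (h + (m + a * s)) + m * p      ∎
          where
          expand : ∀ a m L s → a * ((1 + 2 * m) * L + s) ≡ (1 + 2 * m) * (a * L) + a * s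
          expand = ℕ-Solver.solve-∀
          regroup : ∀ m h a s → (1 + 2 * m) * suc h + a * s ≡ suc (h + (m + a * s)) + m * (1 + 2 * h)
          regroup = ℕ-Solver.solve-∀
        R<p : suc (h + (m + a * s)) < p
        R<p = s≤s (subst (_≤ h + (h + 0)) (+-suc h _) (+-monoʳ-≤ h (subst (suc (m + a * s) ≤_) (sym (+-identityʳ h))
                (≤-pred (subst (suc (suc m) + a * s ≤_) aL≡1+h
                  (k+a*s≤a*L (≤-trans (s≤s (s≤s (m≤m+n m (m + 0)))) t<a) s<L))))))

    ∏gaussSign-blocks-of-h : a * L ≡ h → ∏[ i < h ] ε (suc i) ≡ ∏[ t < a ] (-1ℤ ℤ.^ t) ℤ.^ L
    ∏gaussSign-blocks-of-h aL≡h = begin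
      ∏[ i < h ] ε (suc i)                    ≡⟨ cong (λ n → ∏[ i < n ] ε (suc i)) aL≡h ⟨
      ∏[ i < a * L ] ε (suc i)                ≡⟨ ∏-blocks a L (ε ∘ suc) (-1ℤ ℤ.^_) block-sign ⟩
      ∏[ t < a ] (-1ℤ ℤ.^ t) ℤ.^ L            ∎
      where
      open ≡-Reasoning
      a*[1+s]≤h : ∀ {s} → s < L → a * suc s ≤ h
      a*[1+s]≤h s<L = subst (_ ≤_) aL≡h (*-monoʳ-≤ a s<L)
      block-sign : ∀ {t s} → t < a → s < L → ε (suc (t * L + s)) ≡ -1ℤ ℤ.^ t
      block-sign {t} {s} t<a s<L with even⊎odd t
      ... | m , inj₁ refl = trans (gaussSign-low a m eq (≤-trans (m∸n≤m (a * suc s) m) (a*[1+s]≤h s<L)))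
                                  (sym (-1^[2*k]≡1 m))
        where
        m≤a[1+s] : m ≤ a * suc s
        m≤a[1+s] = ≤-trans (≤-trans (m≤m+n m (m + 0)) (<⇒≤ t<a)) (m≤m*n a (suc s))
        eq : a * suc (2 * m * L + s) ≡ (a * suc s ∸ m) + m * p
        eq = begin
          a * suc (2 * m * L + s)                     ≡⟨ expand a m L s ⟩
          2 * m * (a * L) + a * suc s                 ≡⟨ cong₂ (λ n k → 2 * m * n + k) (sym aL≡h) (m+[n∸m]≡n m≤a[1+s]) ⟨
          2 * m * h + (m + (a * suc s ∸ m))           ≡⟨ regroup m h (a * suc s ∸ m) ⟩
          (a * suc s ∸ m) + m * p                     ∎
          where
          expand : ∀ a m L s → a * suc (2 * m * L + s) ≡ 2 * m * (a * L) + a * suc s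
          expand = ℕ-Solver.solve-∀
          regroup : ∀ m h R → 2 * m * h + (m + R) ≡ R + m * (1 + 2 * h)
          regroup = ℕ-Solver.solve-∀
      ... | m , inj₂ refl = trans (gaussSign-high a m eq h<R R<p) (sym (-1^[1+2*k]≡-1 m))
        where
        m<a[1+s] : m < a * suc s
        m<a[1+s] = <-≤-trans (≤-<-trans (m≤m+n m (m + 0)) (<-trans (n<1+n _) t<a)) (m≤m*n a (suc s))
        R : ℕ
        R = a * suc s ∸ m
        eq : a * suc ((1 + 2 * m) * L + s) ≡ (h + R) + m * p
        eq = begin
          a * suc ((1 + 2 * m) * L + s)               ≡⟨ expand a m L s ⟩
          (1 + 2 * m) * (a * L) + a * suc s           ≡⟨ cong₂ (λ n k → (1 + 2 * m) * n + k) (sym aL≡h) (m+[n∸m]≡n (<⇒≤ m<a[1+s])) ⟨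
          (1 + 2 * m) * h + (m + R)                   ≡⟨ regroup m h R ⟩
          (h + R) + m * p                             ∎
          where
          expand : ∀ a m L s → a * suc ((1 + 2 * m) * L + s) ≡ (1 + 2 * m) * (a * L) + a * suc s
          expand = ℕ-Solver.solve-∀
          regroup : ∀ m h R → (1 + 2 * m) * h + (m + R) ≡ (h + R) + m * (1 + 2 * h)
          regroup = ℕ-Solver.solve-∀
        h<R : h < h + R
        h<R = m<m+n h (m<n⇒0<n∸m m<a[1+s])
        R<p : h + R < p
        R<p = s≤s (+-monoʳ-≤ h (subst (R ≤_) (sym (+-identityʳ h)) (≤-trans (m∸n≤m (a * suc s) m) (a*[1+s]≤h s<L))))

  a*2X≡1+h⇒a^h≈1 : ∀ a X → a * (2 * X) ≡ suc h → (+ a) ℤ.^ h ≈ 1ℤ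
  a*2X≡1+h⇒a^h≈1 a X aL≡1+h = begin
    (+ a) ℤ.^ h                            ≈⟨ gauss-lemma a p∤a ⟩
    ∏[ i < h ] gaussSign a (suc i)         ≡⟨ ∏gaussSign-blocks-of-1+h aL≡1+h ⟩
    ∏[ t < a ] (-1ℤ ℤ.^ t) ℤ.^ (2 * X)     ≡⟨ ∏[-1^t]^[2*X]≡1 a X ⟩
    1ℤ                                     ∎
    where
    open ≈-Reasoning
    a∣1+h : a ∣ suc h
    a∣1+h = divides (2 * X) (trans (sym aL≡1+h) (*-comm a (2 * X)))
    0<a : 0 < a
    0<a = n≢0⇒n>0 λ { refl → 0≢1+n aL≡1+h }
    p∤a : ¬ p ∣ a
    p∤a = ¬p∣-below 0<a (≤-<-trans (∣⇒≤ a∣1+h) 1+h<p)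

  a*2X≡h⇒a^h≈1 : ∀ a X → a * (2 * X) ≡ h → (+ a) ℤ.^ h ≈ 1ℤ
  a*2X≡h⇒a^h≈1 a X aL≡h = begin
    (+ a) ℤ.^ h                            ≈⟨ gauss-lemma a p∤a ⟩
    ∏[ i < h ] gaussSign a (suc i)         ≡⟨ ∏gaussSign-blocks-of-h aL≡h ⟩
    ∏[ t < a ] (-1ℤ ℤ.^ t) ℤ.^ (2 * X)     ≡⟨ ∏[-1^t]^[2*X]≡1 a X ⟩
    1ℤ                                     ∎
    where
    open ≈-Reasoning
    a∣h : a ∣ h
    a∣h = divides (2 * X) (trans (sym aL≡h) (*-comm a (2 * X)))
    0<a : 0 < a
    0<a = n≢0⇒n>0 λ { refl → <⇒≢ 0<h aL≡h }
    p∤a : ¬ p ∣ a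
    p∤a = ¬p∣-below 0<a (≤-<-trans (∣⇒≤ {{>-nonZero 0<h}} a∣h) h<p)

  h≡2*odd⇒2^h≈-1 : ∀ Y → h ≡ 2 * (1 + 2 * Y) → (+ 2) ℤ.^ h ≈ -1ℤ
  h≡2*odd⇒2^h≈-1 Y h≡ = begin
    (+ 2) ℤ.^ h                                ≈⟨ gauss-lemma 2 (¬p∣-below z<s 3≤p) ⟩
    ∏[ i < h ] gaussSign 2 (suc i)             ≡⟨ ∏gaussSign-blocks-of-h {2} {1 + 2 * Y} (sym h≡) ⟩
    ∏[ t < 2 ] (-1ℤ ℤ.^ t) ℤ.^ (1 + 2 * Y)     ≡⟨ cong₂ (λ x y → 1ℤ ℤ.* x ℤ.* y) (ℤ.^-zeroˡ (1 + 2 * Y)) (-1^[1+2*k]≡-1 Y) ⟩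
    -1ℤ                                        ∎
    where open ≈-Reasoning

  odd-h∧v*2X≡1+h⇒nonResidue[-v] : ∀ v X Y → v * (2 * X) ≡ suc h → h ≡ 1 + 2 * Y → LegendreMinusOne (ℤ.- + v) p
  odd-h∧v*2X≡1+h⇒nonResidue[-v] v X Y vL≡1+h h≡ = euler⇒nonResidue (ℤ.- + v) (begin
    (ℤ.- + v) ℤ.^ h                 ≡⟨ cong (ℤ._^ h) (ℤ.-1*i≡-i (+ v)) ⟨
    (-1ℤ ℤ.* + v) ℤ.^ h             ≡⟨ ^-distrib-* -1ℤ (+ v) h ⟩
    -1ℤ ℤ.^ h ℤ.* (+ v) ℤ.^ h       ≈⟨ *-cong (≡⇒≈ (trans (cong (-1ℤ ℤ.^_) h≡) (-1^[1+2*k]≡-1 Y))) (a*2X≡1+h⇒a^h≈1 v X vL≡1+h) ⟩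
    -1ℤ ℤ.* 1ℤ                      ≡⟨⟩
    -1ℤ                             ∎)
    where open ≈-Reasoning

  h≡2*odd∧w*2X≡h⇒nonResidue[-2w] : ∀ w X Y → w * (2 * X) ≡ h → h ≡ 2 * (1 + 2 * Y) → LegendreMinusOne (ℤ.- + (2 * w)) p
  h≡2*odd∧w*2X≡h⇒nonResidue[-2w] w X Y wL≡h h≡ = euler⇒nonResidue (ℤ.- + (2 * w)) (begin
    (ℤ.- + (2 * w)) ℤ.^ h                           ≡⟨ cong (ℤ._^ h) (trans (ℤ.-1*i≡-i (+ 2 ℤ.* + w)) (cong ℤ.-_ (sym (ℤ.pos-* 2 w)))) ⟨
    (-1ℤ ℤ.* (+ 2 ℤ.* + w)) ℤ.^ h                   ≡⟨ trans (^-distrib-* -1ℤ _ h) (cong (-1ℤ ℤ.^ h ℤ.*_) (^-distrib-* (+ 2) (+ w) h)) ⟩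
    -1ℤ ℤ.^ h ℤ.* ((+ 2) ℤ.^ h ℤ.* (+ w) ℤ.^ h)     ≈⟨ *-cong (≡⇒≈ (trans (cong (-1ℤ ℤ.^_) h≡) (-1^[2*k]≡1 (1 + 2 * Y))))
                                                              (*-cong (h≡2*odd⇒2^h≈-1 Y h≡) (a*2X≡h⇒a^h≈1 w X wL≡h)) ⟩
    1ℤ ℤ.* (-1ℤ ℤ.* 1ℤ)                             ≡⟨⟩
    -1ℤ                                             ∎)
    where open ≈-Reasoning

-- The residue classes

∣+m-+n∣≡m∸n : ∀ {m n} → n ≤ m → ℤ.∣ + m ℤ.- + n ∣ ≡ m ∸ n
∣+m-+n∣≡m∸n {m} {n} n≤m = trans (cong ℤ.∣_∣ (ℤ.m-n≡m⊖n m n)) (trans (ℤ.∣m⊖n∣≡∣n⊖m∣ m n) (ℤ.∣⊖∣-≤ n≤m))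

≡[mod]⇒≡+* : ∀ {p q Q} → q < Q → p ≡ q [mod Q ] → ∃ λ n → p ≡ q + n * Q
≡[mod]⇒≡+* {p} {q} {Q} q<Q Q∣p-q with ≤-total q p
... | inj₁ q≤p with divides n p∸q≡n*Q ← subst (Q ∣_) (∣+m-+n∣≡m∸n q≤p) Q∣p-q =
  n , trans (sym (m+[n∸m]≡n q≤p)) (cong (_+_ q) p∸q≡n*Q)
... | inj₂ p≤q = 0 , trans (≤-antisym p≤q (m∸n≡0⇒m≤n q∸p≡0)) (sym (+-identityʳ q))
  where
  Q∣q∸p : Q ∣ q ∸ p
  Q∣q∸p = subst (Q ∣_) (trans (cong ℤ.∣_∣ (ℤ.m-n≡m⊖n p q)) (ℤ.∣⊖∣-≤ p≤q)) Q∣p-q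
  q∸p≡0 : q ∸ p ≡ 0
  q∸p≡0 = ∣∧<⇒≡0 Q∣q∸p (≤-<-trans (m∸n≤m q p) q<Q)

2q≡Q±2⇒coprime : ∀ x Q → (Q + 2 ≡ 2 * (1 + 2 * x) ⊎ 2 * (1 + 2 * x) + 2 ≡ Q) → Coprime (1 + 2 * x) Q
2q≡Q±2⇒coprime x Q 2q≡Q±2 {d} (d∣q , d∣Q) = odd-coprime-2 x (d∣q , d∣2 2q≡Q±2)
  where
  d∣2q : d ∣ 2 * (1 + 2 * x)
  d∣2q = ∣n⇒∣m*n 2 d∣q
  d∣2 : (Q + 2 ≡ 2 * (1 + 2 * x) ⊎ 2 * (1 + 2 * x) + 2 ≡ Q) → d ∣ 2
  d∣2 (inj₁ Q+2≡2q) = ∣m+n∣m⇒∣n (subst (d ∣_) (sym Q+2≡2q) d∣2q) d∣Q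
  d∣2 (inj₂ 2q+2≡Q) = ∣m+n∣m⇒∣n (subst (d ∣_) (sym 2q+2≡Q) d∣Q) d∣2q

PrimeConditions : ℕ → ℕ → ℕ → ℕ → Set
PrimeConditions u v Q p =
  ((u ∣ p * p ∸ 1) × LegendreMinusOne (ℤ.- (+ v)) p) × SameValuation 2 (p * p ∸ 1) Q

GoodValuedClass : ℕ → ℕ → ℕ → ℕ → Set
GoodValuedClass u v Q q =
  GoodClass u v Q q × (∀ p → Prime p → p ≡ q [mod Q ] → SameValuation 2 (p * p ∸ 1) Q)

goodValuedClass : ∀ {u v Q q} → q < Q → Coprime q Q →
                  (∀ p → Prime p → p ≡ q [mod Q ] → PrimeConditions u v Q p) → GoodValuedClass u v Q q
goodValuedClass q<Q coprime conditions =
  (q<Q , coprime , λ p p-prime p≡q → proj₁ (conditions p p-prime p≡q)) ,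
  λ p p-prime p≡q → proj₂ (conditions p p-prime p≡q)

p²-1≡Q*odd⇒conditions : ∀ {u Q} p m → .{{NonZero Q}} → u ∣ Q → p * p ∸ 1 ≡ Q * (1 + 2 * m) →
                         (u ∣ p * p ∸ 1) × SameValuation 2 (p * p ∸ 1) Q
p²-1≡Q*odd⇒conditions {u} {Q} p m u∣Q p²-1≡ =
  subst (u ∣_) (sym p²-1≡) (∣-trans u∣Q (m∣m*n (1 + 2 * m))) ,
  subst (λ n → SameValuation 2 n Q) (sym p²-1≡) (sameValuation-*odd Q m)

goodValuedClass-below-half : ∀ {u v} k → u ∣ 8 * suc k → v ∣ suc k →
                             GoodValuedClass u v (8 * suc k) (1 + 2 * (1 + 2 * k))
goodValuedClass-below-half {u} {v} k u∣Q (divides d 1+k≡d*v) = goodValuedClass q<Q coprime conditions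
  where
  Q : ℕ
  Q = 8 * suc k
  q : ℕ
  q = 1 + 2 * (1 + 2 * k)
  q<Q : q < Q
  q<Q = subst (q <_) (sym (Q≡ k)) (m<m+n q z<s)
    where
    Q≡ : ∀ k → 8 * suc k ≡ 1 + 2 * (1 + 2 * k) + (5 + 4 * k)
    Q≡ = ℕ-Solver.solve-∀
  coprime : Coprime q Q
  coprime = 2q≡Q±2⇒coprime (1 + 2 * k) Q (inj₂ (2q+2≡Q k))
    where
    2q+2≡Q : ∀ k → 2 * (1 + 2 * (1 + 2 * k)) + 2 ≡ 8 * suc k
    2q+2≡Q = ℕ-Solver.solve-∀
  p≡1+2h : ∀ k n → 1 + 2 * (1 + 2 * k) + n * (8 * suc k) ≡ 1 + 2 * (1 + 2 * k + n * (4 * suc k))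
  p≡1+2h = ℕ-Solver.solve-∀
  conditions-at : ∀ n → let h = 1 + 2 * k + n * (4 * suc k) in Prime (1 + 2 * h) → PrimeConditions u v Q (1 + 2 * h)
  conditions-at n h-prime =
    (proj₁ u∣∧val , odd-h∧v*2X≡1+h⇒nonResidue[-v] v (d * (1 + 2 * n)) A v*2X≡1+h (h≡odd k n)) , proj₂ u∣∧val
    where
    h : ℕ
    h = 1 + 2 * k + n * (4 * suc k)
    A : ℕ
    A = k + n * (2 * suc k)
    h≡odd : ∀ k n → 1 + 2 * k + n * (4 * suc k) ≡ 1 + 2 * (k + n * (2 * suc k))
    h≡odd = ℕ-Solver.solve-∀
    1+h≡ : ∀ k n → suc (1 + 2 * k + n * (4 * suc k)) ≡ 2 * suc k * (1 + 2 * n)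
    1+h≡ = ℕ-Solver.solve-∀
    open OddPrime h h-prime
    v*2X≡1+h : v * (2 * (d * (1 + 2 * n))) ≡ suc h
    v*2X≡1+h = trans (regroup v d n) (sym (trans (1+h≡ k n) (cong (λ c → 2 * c * (1 + 2 * n)) 1+k≡d*v)))
      where
      regroup : ∀ v d n → v * (2 * (d * (1 + 2 * n))) ≡ 2 * (d * v) * (1 + 2 * n)
      regroup = ℕ-Solver.solve-∀
    p²-1≡Q*odd : (1 + 2 * h) * (1 + 2 * h) ∸ 1 ≡ Q * (1 + 2 * (A + n + 2 * A * n))
    p²-1≡Q*odd = begin
      (1 + 2 * h) * (1 + 2 * h) ∸ 1       ≡⟨ odd²∸1 h ⟩
      4 * h * suc h                       ≡⟨ cong (4 * h *_) (1+h≡ k n) ⟩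
      4 * h * (2 * suc k * (1 + 2 * n))   ≡⟨ regroup h k n ⟩
      Q * (h * (1 + 2 * n))               ≡⟨ cong (λ x → Q * (x * (1 + 2 * n))) (h≡odd k n) ⟩
      Q * ((1 + 2 * A) * (1 + 2 * n))     ≡⟨ cong (Q *_) (odd*odd A n) ⟩
      Q * (1 + 2 * (A + n + 2 * A * n))   ∎
      where
      open ≡-Reasoning
      regroup : ∀ h k n → 4 * h * (2 * suc k * (1 + 2 * n)) ≡ 8 * suc k * (h * (1 + 2 * n))
      regroup = ℕ-Solver.solve-∀
    u∣∧val : (u ∣ (1 + 2 * h) * (1 + 2 * h) ∸ 1) × SameValuation 2 ((1 + 2 * h) * (1 + 2 * h) ∸ 1) Q
    u∣∧val = p²-1≡Q*odd⇒conditions (1 + 2 * h) (A + n + 2 * A * n) u∣Q p²-1≡Q*odd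

  conditions : ∀ p → Prime p → p ≡ q [mod Q ] → PrimeConditions u v Q p
  conditions p p-prime p≡q with n , refl ← ≡[mod]⇒≡+* {p} q<Q p≡q =
    subst (PrimeConditions u v Q) (sym (p≡1+2h k n)) (conditions-at n (subst Prime (p≡1+2h k n) p-prime))

goodValuedClass-above-half : ∀ {u w} o → u ∣ 8 * (1 + 2 * o) → w ∣ 1 + 2 * o →
                             GoodValuedClass u (2 * w) (8 * (1 + 2 * o)) (1 + 2 * (2 * (1 + 2 * o)))
goodValuedClass-above-half {u} {w} o u∣Q (divides g O≡g*w) = goodValuedClass q<Q coprime conditions
  where
  O : ℕ
  O = 1 + 2 * o
  Q : ℕ
  Q = 8 * O
  q : ℕ
  q = 1 + 2 * (2 * O)
  q<Q : q < Q
  q<Q = subst (q <_) (sym (Q≡ o)) (m<m+n q z<s)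
    where
    Q≡ : ∀ o → 8 * (1 + 2 * o) ≡ 1 + 2 * (2 * (1 + 2 * o)) + (3 + 8 * o)
    Q≡ = ℕ-Solver.solve-∀
  coprime : Coprime q Q
  coprime = 2q≡Q±2⇒coprime (2 * O) Q (inj₁ (Q+2≡2q o))
    where
    Q+2≡2q : ∀ o → 8 * (1 + 2 * o) + 2 ≡ 2 * (1 + 2 * (2 * (1 + 2 * o)))
    Q+2≡2q = ℕ-Solver.solve-∀
  p≡1+2h : ∀ o n → 1 + 2 * (2 * (1 + 2 * o)) + n * (8 * (1 + 2 * o)) ≡ 1 + 2 * (2 * ((1 + 2 * o) * (1 + 2 * n)))
  p≡1+2h = ℕ-Solver.solve-∀
  conditions-at : ∀ n → let h = 2 * (O * (1 + 2 * n)) in Prime (1 + 2 * h) → PrimeConditions u (2 * w) Q (1 + 2 * h)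
  conditions-at n h-prime =
    (proj₁ u∣∧val , h≡2*odd∧w*2X≡h⇒nonResidue[-2w] w (g * (1 + 2 * n)) B w*2X≡h h≡2*odd) , proj₂ u∣∧val
    where
    h : ℕ
    h = 2 * (O * (1 + 2 * n))
    B : ℕ
    B = o + n + 2 * o * n
    C : ℕ
    C = n + O * (1 + 2 * n) + 2 * n * (O * (1 + 2 * n))
    open OddPrime h h-prime
    h≡2*odd : h ≡ 2 * (1 + 2 * B)
    h≡2*odd = cong (2 *_) (odd*odd o n)
    w*2X≡h : w * (2 * (g * (1 + 2 * n))) ≡ h
    w*2X≡h = trans (regroup w g n) (cong (λ c → 2 * (c * (1 + 2 * n))) (sym O≡g*w))
      where
      regroup : ∀ w g n → w * (2 * (g * (1 + 2 * n))) ≡ 2 * (g * w * (1 + 2 * n))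
      regroup = ℕ-Solver.solve-∀
    p²-1≡Q*odd : (1 + 2 * h) * (1 + 2 * h) ∸ 1 ≡ Q * (1 + 2 * C)
    p²-1≡Q*odd = begin
      (1 + 2 * h) * (1 + 2 * h) ∸ 1                     ≡⟨ odd²∸1 h ⟩
      4 * (2 * (O * (1 + 2 * n))) * suc h               ≡⟨ regroup O n (suc h) ⟩
      Q * ((1 + 2 * n) * (1 + 2 * (O * (1 + 2 * n))))   ≡⟨ cong (Q *_) (odd*odd n (O * (1 + 2 * n))) ⟩
      Q * (1 + 2 * C)                                   ∎
      where
      open ≡-Reasoning
      regroup : ∀ O n s → 4 * (2 * (O * (1 + 2 * n))) * s ≡ 8 * O * ((1 + 2 * n) * s)
      regroup = ℕ-Solver.solve-∀
    u∣∧val : (u ∣ (1 + 2 * h) * (1 + 2 * h) ∸ 1) × SameValuation 2 ((1 + 2 * h) * (1 + 2 * h) ∸ 1) Q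
    u∣∧val = p²-1≡Q*odd⇒conditions (1 + 2 * h) C u∣Q p²-1≡Q*odd
  conditions : ∀ p → Prime p → p ≡ q [mod Q ] → PrimeConditions u (2 * w) Q p
  conditions p p-prime p≡q with n , refl ← ≡[mod]⇒≡+* {p} q<Q p≡q =
    subst (PrimeConditions u (2 * w) Q) (sym (p≡1+2h o n)) (conditions-at n (subst Prime (p≡1+2h o n) p-prime))

8∣⇒≡8*suc : ∀ {Q} → .{{NonZero Q}} → 8 ∣ Q → ∃ λ k → Q ≡ 8 * suc k
8∣⇒≡8*suc {Q} (divides zero Q≡0) = ⊥-elim (≢-nonZero⁻¹ Q Q≡0)
8∣⇒≡8*suc (divides (suc k) Q≡[1+k]*8) = k , trans Q≡[1+k]*8 (*-comm (suc k) 8)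

squarefree∣8*⇒cases : ∀ {v} k → SquareFree v → v ∣ 8 * suc k →
                      v ∣ suc k ⊎ ∃₂ λ w o → v ≡ 2 * w × suc k ≡ 1 + 2 * o × w ∣ 1 + 2 * o
squarefree∣8*⇒cases {v} k sf v∣8[1+k] with even⊎odd v
... | x , inj₂ refl = inj₁ (odd∣8*⇒∣ x v∣8[1+k])
... | w , inj₁ refl with even⊎odd w
...   | y , inj₁ refl = ⊥-elim (2≢1 (sf 2 (divides y (4y≡ y))))
  where
  4y≡ : ∀ y → 2 * (2 * y) ≡ y * (2 * 2)
  4y≡ = ℕ-Solver.solve-∀
  2≢1 : 2 ≢ 1
  2≢1 ()
...   | y , inj₂ refl with even⊎odd (suc k) | odd∣8*⇒∣ y (∣-trans (n∣m*n 2) v∣8[1+k])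
...     | o , inj₂ 1+k≡odd | w∣1+k = inj₂ (1 + 2 * y , o , refl , 1+k≡odd , subst (1 + 2 * y ∣_) 1+k≡odd w∣1+k)
...     | c , inj₁ 1+k≡2c | w∣1+k = inj₁ (subst (2 * (1 + 2 * y) ∣_) (sym 1+k≡2c) (*-monoʳ-∣ 2 w∣c))
  where
  w∣c : 1 + 2 * y ∣ c
  w∣c = odd∣2*⇒∣ y (subst (1 + 2 * y ∣_) 1+k≡2c w∣1+k)

goodValuedClass-exists : ∀ {u v Q} → .{{NonZero Q}} → SquareFree v → 8 ∣ Q → u ∣ Q → v ∣ Q →
                         ∃ (GoodValuedClass u v Q)
goodValuedClass-exists sf 8∣Q u∣Q v∣Q with 8∣⇒≡8*suc 8∣Q
... | k , refl with squarefree∣8*⇒cases k sf v∣Q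
...   | inj₁ v∣1+k = _ , goodValuedClass-below-half k u∣Q v∣1+k
...   | inj₂ (w , o , refl , refl , w∣odd) = _ , goodValuedClass-above-half o u∣Q w∣odd

lemma3p2 : (u v : ℕ) → .{{NonZero u}} → .{{NonZero v}} → SquareFree v →
    let Q = lcm 8 (lcm u v) in
    (∃ λ q → GoodClass u v Q q) ×
    ((∃ λ r → Prime r × r ∣ v × r % 4 ≡ 3) → 8 ∣ u →
      ∃ λ q → GoodClass u v Q q ×
        (∀ p → Prime p → p ≡ q [mod Q ] → SameValuation 2 (p * p ∸ 1) Q))
lemma3p2 u v sf = (q , proj₁ good) , λ _ _ → q , good
  where
  instance
    Q≢0 : NonZero (lcm 8 (lcm u v))
    Q≢0 = lcm-nonZero 8 (lcm u v) {{_}} {{lcm-nonZero u v}}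
  class : ∃ (GoodValuedClass u v (lcm 8 (lcm u v)))
  class = goodValuedClass-exists sf (m∣lcm[m,n] 8 (lcm u v))
            (∣-trans (m∣lcm[m,n] u v) (n∣lcm[m,n] 8 (lcm u v)))
            (∣-trans (n∣lcm[m,n] u v) (n∣lcm[m,n] 8 (lcm u v)))
  q : ℕ
  q = proj₁ class
  good : GoodValuedClass u v (lcm 8 (lcm u v)) q
  good = proj₂ class
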